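{- Let $(\alpha_n)_{n\ge0}$ be a sequence of complex numbers and $A_n(x)=\sum_{\nu=0}^{n}\binom{n}{\nu}\alpha_{n-\nu}x^\nu$. For $r,s\ge0$ let $\alpha_{r,s}=\sum_{\nu=0}^{r}\binom{r}{\nu}\alpha_{s+\nu}$; for $0\le k\le n$ let $a_{n,k}=\sum_{\nu=k}^{n}\binom{n}{\nu}\binom{\nu}{k}\alpha_\nu$ and $C_n(x)=\sum_{k=0}^{n}a_{n,k}x^k$. Then for $n\ge0$, $$C_n(x)=\sum_{\nu=0}^{n}\binom{n}{\nu}\alpha_{\nu,n-\nu}x^{n-\nu},\qquad a_{n,\nu}=\binom{n}{\nu}\alpha_{n-\nu,\nu}\quad(0\le\nu\le n).$$ If moreover $A_m(1-x)=(-1)^mA_m(x)$ for all $m\ge0$, then $C_n(x)=(-1)^nx^nC_n(x^{ -1})$ and $a_{n,\nu}=(-1)^na_{n,n-\nu}$ for $0\le\nu\le n$.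
   Context: $\alpha_0=0$ is allowed. -}

module Defs where

open import Level using (Level)
open import Data.Nat using (ℕ; zero; suc; _∸_; _≤_) renaming (_+_ to _+ℕ_)
open import Data.Nat.Combinatorics using (_C_)
open import Data.Sum using (_⊎_)
open import Data.Product using (_×_)
open import Relation.Binary.PropositionalEquality using (_≡_)
open import Relation.Nullary using (¬_)
open import Algebra.Bundles using (CommutativeRing)

IsIntegralDomain : ∀ {c ℓ} → CommutativeRing c ℓ → Set _
IsIntegralDomain R = (¬ (1# ≈ 0#)) × (∀ x y → x * y ≈ 0# → (x ≈ 0#) ⊎ (y ≈ 0#))
  where open CommutativeRing R using (1#; 0#; _≈_; _*_)

HasCharZero : ∀ {c ℓ} → CommutativeRing c ℓ → Set _
HasCharZero R = ∀ (n : ℕ) → (n ·ℕ 1#) ≈ 0# → n ≡ 0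
  where open CommutativeRing R using (1#; 0#; _≈_; semiring)
        open import Algebra.Bundles using (Semiring)
        open import Algebra.Definitions.RawSemiring (Semiring.rawSemiring semiring) using () renaming (_×_ to _·ℕ_)

module Poly {c ℓ} (R : CommutativeRing c ℓ) where
  open CommutativeRing R
  open import Algebra.Bundles using (Semiring)
  open import Algebra.Definitions.RawSemiring (Semiring.rawSemiring semiring) using (_^_) renaming (_×_ to _·_)

  pow : Carrier → ℕ → Carrier
  pow x n = x ^ n

  sumTo : ℕ → (ℕ → Carrier) → Carrier
  sumTo zero    f = f 0
  sumTo (suc n) f = sumTo n f + f (suc n)

  -- Σ_{ν=k}^{n} f ν   (used only with k ≤ n)
  sumFromTo : ℕ → ℕ → (ℕ → Carrier) → Carrier
  sumFromTo k n f = sumTo (n ∸ k) (λ i → f (k +ℕ i))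

  bin : ℕ → ℕ → Carrier → Carrier
  bin n k a = (n C k) · a

  sgn : ℕ → Carrier
  sgn n = (- 1#) ^ n

  module _ (α : ℕ → Carrier) where
    A : ℕ → Carrier → Carrier
    A n x = sumTo n (λ ν → bin n ν (α (n ∸ ν) * x ^ ν))

    α₂ : ℕ → ℕ → Carrier
    α₂ r s = sumTo r (λ ν → bin r ν (α (s +ℕ ν)))

    a : ℕ → ℕ → Carrier
    a n k = sumFromTo k n (λ ν → bin n ν (bin ν k (α ν)))

    Cpoly : ℕ → Carrier → Carrier
    Cpoly n x = sumTo n (λ k → a n k * x ^ k)

-- The numbers α_{r,s} obey Pascal's rule α_{r+1,s} = α_{r,s} + α_{r,s+1}.  Expanding
-- a_{n,k} with C(n,ν) C(ν,k) = C(n,k) C(n-k,ν-k) gives a_{n,k} = C(n,k) α_{n-k,k}, and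
-- reversing the summation in C_n gives its first formula.  Of the reflection hypothesis
-- only the instance x = 0 is needed: it says α_{m,0} = A_m(1) = (-1)^m A_m(0) = (-1)^m α_{0,m},
-- and Pascal's rule propagates this to α_{r,s} = (-1)^{r+s} α_{s,r}, which is the symmetry
-- of the a_{n,k}; the reciprocity of C_n follows by reversing the sum once more.
{-# OPTIONS --safe #-}
module Submission where

open import Defs
open import Data.Nat as ℕ using (ℕ; zero; suc; _∸_; _≤_; z≤n)
import Data.Nat.Properties as ℕ
open import Data.Nat.Combinatorics using (_C_; nCk≡nC[n∸k]; nCk+nC[k+1]≡[n+1]C[k+1]; k>n⇒nCk≡0)
open import Data.Product using (_×_; _,_)
open import Relation.Binary.PropositionalEquality as ≡ using (_≡_)
open import Algebra.Bundles using (CommutativeRing; Semiring)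

module BinomialCoefficients where
  open import Data.Nat using (_*_; _!; NonZero)
  open import Data.Nat.Properties
  open import Data.Nat.Combinatorics using (nCk≡n!/k![n-k]!; k![n∸k]!∣n!)
  open import Data.Nat.DivMod using (_/_; m/n*n≡m)
  open import Data.Nat.Tactic.RingSolver using (solve-∀)
  open ≡ using (cong; sym)
  open ≡.≡-Reasoning

  nCk*[k!*[n∸k]!]≡n! : ∀ {n k} → k ≤ n → (n C k) * (k ! * (n ∸ k) !) ≡ n !
  nCk*[k!*[n∸k]!]≡n! {n} {k} k≤n = begin
    (n C k) * (k ! * (n ∸ k) !)                                       ≡⟨ cong (_* (k ! * (n ∸ k) !)) (nCk≡n!/k![n-k]! k≤n) ⟩
    (n ! / (k ! * (n ∸ k) !)) {{k !* (n ∸ k) !≢0}} * (k ! * (n ∸ k) !) ≡⟨ m/n*n≡m {{k !* (n ∸ k) !≢0}} (k![n∸k]!∣n! k≤n) ⟩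
    n !                                                               ∎

  -- Both sides times k! (m-k)! (n-m)! equal n!.
  nCm*mCk≡nCk*[n∸k]C[m∸k] : ∀ {n m k} → k ≤ m → m ≤ n → (n C m) * (m C k) ≡ (n C k) * ((n ∸ k) C (m ∸ k))
  nCm*mCk≡nCk*[n∸k]C[m∸k] {n} {m} {k} k≤m m≤n = *-cancelʳ-≡ _ _ (a * b * c) {{a*b*c≢0}} (≡.trans lhs (sym rhs))
    where
    a b c : ℕ
    a = k !
    b = (m ∸ k) !
    c = (n ∸ m) !
    a*b*c≢0 : NonZero (a * b * c)
    a*b*c≢0 = m*n≢0 (a * b) c {{m*n≢0 a b {{k !≢0}} {{(m ∸ k) !≢0}}}} {{(n ∸ m) !≢0}}
    n∸k∸[m∸k]≡n∸m : n ∸ k ∸ (m ∸ k) ≡ n ∸ m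
    n∸k∸[m∸k]≡n∸m = ≡.trans (∸-+-assoc n k (m ∸ k)) (cong (n ∸_) (m+[n∸m]≡n k≤m))
    regroupˡ : ∀ p q a b c → p * q * (a * b * c) ≡ p * (q * (a * b) * c)
    regroupˡ = solve-∀
    regroupʳ : ∀ p q a b c → p * q * (a * b * c) ≡ p * (a * (q * (b * c)))
    regroupʳ = solve-∀
    lhs : (n C m) * (m C k) * (a * b * c) ≡ n !
    lhs = begin
      (n C m) * (m C k) * (a * b * c)   ≡⟨ regroupˡ (n C m) (m C k) a b c ⟩
      (n C m) * ((m C k) * (a * b) * c) ≡⟨ cong (λ z → (n C m) * (z * c)) (nCk*[k!*[n∸k]!]≡n! k≤m) ⟩
      (n C m) * (m ! * c)               ≡⟨ nCk*[k!*[n∸k]!]≡n! m≤n ⟩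
      n !                               ∎
    rhs : (n C k) * ((n ∸ k) C (m ∸ k)) * (a * b * c) ≡ n !
    rhs = begin
      (n C k) * ((n ∸ k) C (m ∸ k)) * (a * b * c)                       ≡⟨ regroupʳ (n C k) ((n ∸ k) C (m ∸ k)) a b c ⟩
      (n C k) * (a * (((n ∸ k) C (m ∸ k)) * (b * c)))                   ≡⟨ cong (λ z → (n C k) * (a * (((n ∸ k) C (m ∸ k)) * (b * z !)))) (sym n∸k∸[m∸k]≡n∸m) ⟩
      (n C k) * (a * (((n ∸ k) C (m ∸ k)) * (b * (n ∸ k ∸ (m ∸ k)) !))) ≡⟨ cong (λ z → (n C k) * (a * z)) (nCk*[k!*[n∸k]!]≡n! (∸-monoˡ-≤ k m≤n)) ⟩
      (n C k) * (a * (n ∸ k) !)                                         ≡⟨ nCk*[k!*[n∸k]!]≡n! (≤-trans k≤m m≤n) ⟩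
      n !                                                               ∎

open BinomialCoefficients using (nCm*mCk≡nCk*[n∸k]C[m∸k])

module _ {c ℓ} (R : CommutativeRing c ℓ) where
  open CommutativeRing R
  open Poly R
  open import Algebra.Definitions.RawSemiring (Semiring.rawSemiring semiring) using (_^_) renaming (_×_ to _·_)
  open import Algebra.Properties.Semiring.Mult semiring using (×-homo-+; ×-assocˡ; ×-congʳ; ×-congˡ; ×-comm-*; ×-assoc-*)
  open import Algebra.Properties.CommutativeMonoid.Mult +-commutativeMonoid using (×-distrib-+)
  open import Algebra.Properties.CommutativeSemiring.Exp commutativeSemiring using (^-congˡ; ^-congʳ; ^-homo-*; ^-distrib-*)
  open import Algebra.Properties.CommutativeSemigroup *-commutativeSemigroup using () renaming (x∙yz≈y∙xz to *-x∙yz≈y∙xz)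
  open import Algebra.Properties.CommutativeSemigroup +-commutativeSemigroup using (interchange)
  open import Algebra.Properties.Ring ring using (-1*x≈-x; -0#≈0#)
  open import Algebra.Properties.Group +-group using () renaming (\\-leftDividesʳ to -x+[x+y]≈y)
  open import Relation.Binary.Reasoning.Setoid setoid

  ·-zeroʳ : ∀ k → k · 0# ≈ 0#
  ·-zeroʳ zero    = refl
  ·-zeroʳ (suc k) = trans (+-identityˡ _) (·-zeroʳ k)

  1^n≈1 : ∀ n → 1# ^ n ≈ 1#
  1^n≈1 zero    = refl
  1^n≈1 (suc n) = trans (*-identityˡ _) (1^n≈1 n)

  xy≈1⇒xⁿyᵏ≈xⁿ⁻ᵏ : ∀ {x y} → x * y ≈ 1# → ∀ {n k} → k ≤ n → x ^ n * y ^ k ≈ x ^ (n ∸ k)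
  xy≈1⇒xⁿyᵏ≈xⁿ⁻ᵏ {x} {y} xy≈1 {n} {k} k≤n = begin
    x ^ n * y ^ k                   ≈⟨ *-congʳ (^-congʳ x (≡.sym (ℕ.m∸n+n≡m k≤n))) ⟩
    x ^ (n ∸ k ℕ.+ k) * y ^ k       ≈⟨ *-congʳ (^-homo-* x (n ∸ k) k) ⟩
    x ^ (n ∸ k) * x ^ k * y ^ k     ≈⟨ *-assoc _ _ _ ⟩
    x ^ (n ∸ k) * (x ^ k * y ^ k)   ≈⟨ *-congˡ (^-distrib-* x y k) ⟨
    x ^ (n ∸ k) * (x * y) ^ k       ≈⟨ *-congˡ (trans (^-congˡ k xy≈1) (1^n≈1 k)) ⟩
    x ^ (n ∸ k) * 1#                ≈⟨ *-identityʳ _ ⟩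
    x ^ (n ∸ k)                     ∎

  sumTo-cong : ∀ n {f g : ℕ → Carrier} → (∀ i → i ≤ n → f i ≈ g i) → sumTo n f ≈ sumTo n g
  sumTo-cong zero    f≈g = f≈g 0 z≤n
  sumTo-cong (suc n) f≈g = +-cong (sumTo-cong n (λ i i≤n → f≈g i (ℕ.m≤n⇒m≤1+n i≤n))) (f≈g (suc n) ℕ.≤-refl)

  sumTo-suc : ∀ n (f : ℕ → Carrier) → sumTo (suc n) f ≈ f 0 + sumTo n (λ i → f (suc i))
  sumTo-suc zero    f = refl
  sumTo-suc (suc n) f = trans (+-congʳ (sumTo-suc n f)) (+-assoc _ _ _)

  sumTo-reverse : ∀ n (f : ℕ → Carrier) → sumTo n f ≈ sumTo n (λ i → f (n ∸ i))
  sumTo-reverse zero    f = refl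
  sumTo-reverse (suc n) f = begin
    sumTo n f + f (suc n)                   ≈⟨ +-comm _ _ ⟩
    f (suc n) + sumTo n f                   ≈⟨ +-congˡ (sumTo-reverse n f) ⟩
    f (suc n) + sumTo n (λ i → f (n ∸ i))   ≈⟨ sumTo-suc n (λ i → f (suc n ∸ i)) ⟨
    sumTo (suc n) (λ i → f (suc n ∸ i))     ∎

  sumTo-distrib-+ : ∀ n (f g : ℕ → Carrier) → sumTo n (λ i → f i + g i) ≈ sumTo n f + sumTo n g
  sumTo-distrib-+ zero    f g = refl
  sumTo-distrib-+ (suc n) f g = trans (+-congʳ (sumTo-distrib-+ n f g)) (interchange _ _ _ _)

  ·-distrib-sumTo : ∀ k n (f : ℕ → Carrier) → k · sumTo n f ≈ sumTo n (λ i → k · f i)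
  ·-distrib-sumTo k zero    f = refl
  ·-distrib-sumTo k (suc n) f = trans (×-distrib-+ _ _ k) (+-congʳ (·-distrib-sumTo k n f))

  *-distribˡ-sumTo : ∀ x n (f : ℕ → Carrier) → x * sumTo n f ≈ sumTo n (λ i → x * f i)
  *-distribˡ-sumTo x zero    f = refl
  *-distribˡ-sumTo x (suc n) f = trans (distribˡ _ _ _) (+-congʳ (*-distribˡ-sumTo x n f))

  sumTo-head : ∀ n (f : ℕ → Carrier) → (∀ i → f (suc i) ≈ 0#) → sumTo n f ≈ f 0
  sumTo-head zero    f f≈0 = refl
  sumTo-head (suc n) f f≈0 = trans (+-cong (sumTo-head n f f≈0) (f≈0 n)) (+-identityʳ _)

  binomialSum-suc : ∀ r (f : ℕ → Carrier) →
    sumTo (suc r) (λ i → bin (suc r) i (f i)) ≈ sumTo r (λ i → bin r i (f i)) + sumTo r (λ i → bin r i (f (suc i)))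
  binomialSum-suc r f = begin
    sumTo (suc r) (λ i → bin (suc r) i (f i))                         ≈⟨ sumTo-suc r _ ⟩
    t₀ + sumTo r (λ i → (suc r C suc i) · f (suc i))                   ≈⟨ +-congˡ (sumTo-cong r (λ i _ → pascal i)) ⟩
    t₀ + sumTo r (λ i → (r C i) · f (suc i) + (r C suc i) · f (suc i)) ≈⟨ +-congˡ (sumTo-distrib-+ r _ _) ⟩
    t₀ + (Sᵢ + Sᵢ₊₁)                                                   ≈⟨ +-congˡ (+-comm Sᵢ Sᵢ₊₁) ⟩
    t₀ + (Sᵢ₊₁ + Sᵢ)                                                   ≈⟨ +-assoc _ _ _ ⟨
    (t₀ + Sᵢ₊₁) + Sᵢ                                                   ≈⟨ +-congʳ (sumTo-suc r (λ i → bin r i (f i))) ⟨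
    sumTo (suc r) (λ i → bin r i (f i)) + Sᵢ                           ≈⟨ +-congʳ (+-congˡ (×-congˡ (k>n⇒nCk≡0 (ℕ.n<1+n r)))) ⟩
    (sumTo r (λ i → bin r i (f i)) + 0#) + Sᵢ                          ≈⟨ +-congʳ (+-identityʳ _) ⟩
    sumTo r (λ i → bin r i (f i)) + Sᵢ                                 ∎
    where
    -- n C 0 reduces to 1 for every n, so this is also bin (suc r) 0 (f 0).
    t₀ Sᵢ Sᵢ₊₁ : Carrier
    t₀ = bin r 0 (f 0)
    Sᵢ = sumTo r (λ i → bin r i (f (suc i)))
    Sᵢ₊₁ = sumTo r (λ i → bin r (suc i) (f (suc i)))
    pascal : ∀ i → (suc r C suc i) · f (suc i) ≈ (r C i) · f (suc i) + (r C suc i) · f (suc i)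
    pascal i = trans (×-congˡ (≡.sym (nCk+nC[k+1]≡[n+1]C[k+1] r i))) (×-homo-+ _ (r C i) (r C suc i))

  module _ (α : ℕ → Carrier) where

    α₂-zeroˡ : ∀ s → α₂ α 0 s ≈ α s
    α₂-zeroˡ s = trans (+-identityʳ _) (reflexive (≡.cong α (ℕ.+-identityʳ s)))

    α₂-pascal : ∀ r s → α₂ α (suc r) s ≈ α₂ α r s + α₂ α r (suc s)
    α₂-pascal r s = trans (binomialSum-suc r (λ i → α (s ℕ.+ i)))
      (+-congˡ (sumTo-cong r (λ i _ → ×-congʳ (r C i) (reflexive (≡.cong α (ℕ.+-suc s i))))))

    a≈bin-α₂ : ∀ n k → k ≤ n → a α n k ≈ bin n k (α₂ α (n ∸ k) k)
    a≈bin-α₂ n k k≤n = sym (trans (·-distrib-sumTo (n C k) (n ∸ k) _) (sumTo-cong (n ∸ k) term))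
      where
      term : ∀ i → i ≤ n ∸ k → bin n k (bin (n ∸ k) i (α (k ℕ.+ i))) ≈ bin n (k ℕ.+ i) (bin (k ℕ.+ i) k (α (k ℕ.+ i)))
      term i i≤n∸k = begin
        (n C k) · (((n ∸ k) C i) · α (k ℕ.+ i))                     ≈⟨ ×-assocˡ _ (n C k) _ ⟩
        ((n C k) ℕ.* ((n ∸ k) C i)) · α (k ℕ.+ i)                   ≡⟨ ≡.cong (λ j → ((n C k) ℕ.* ((n ∸ k) C j)) · α (k ℕ.+ i)) (ℕ.m+n∸m≡n k i) ⟨
        ((n C k) ℕ.* ((n ∸ k) C (k ℕ.+ i ∸ k))) · α (k ℕ.+ i)       ≡⟨ ≡.cong (_· α (k ℕ.+ i)) (nCm*mCk≡nCk*[n∸k]C[m∸k] (ℕ.m≤m+n k i) k+i≤n) ⟨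
        ((n C (k ℕ.+ i)) ℕ.* ((k ℕ.+ i) C k)) · α (k ℕ.+ i)         ≈⟨ ×-assocˡ _ (n C (k ℕ.+ i)) _ ⟨
        (n C (k ℕ.+ i)) · (((k ℕ.+ i) C k) · α (k ℕ.+ i))           ∎
        where
        k+i≤n : k ℕ.+ i ≤ n
        k+i≤n = ≡.subst (k ℕ.+ i ≤_) (ℕ.m+[n∸m]≡n k≤n) (ℕ.+-monoʳ-≤ k i≤n∸k)

    a-reflect≈bin-α₂ : ∀ n ν → ν ≤ n → a α n (n ∸ ν) ≈ bin n ν (α₂ α ν (n ∸ ν))
    a-reflect≈bin-α₂ n ν ν≤n = begin
      a α n (n ∸ ν)                                        ≈⟨ a≈bin-α₂ n (n ∸ ν) (ℕ.m∸n≤m n ν) ⟩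
      (n C (n ∸ ν)) · α₂ α (n ∸ (n ∸ ν)) (n ∸ ν)            ≡⟨ ≡.cong (_· α₂ α (n ∸ (n ∸ ν)) (n ∸ ν)) (nCk≡nC[n∸k] ν≤n) ⟨
      (n C ν) · α₂ α (n ∸ (n ∸ ν)) (n ∸ ν)                  ≡⟨ ≡.cong (λ r → (n C ν) · α₂ α r (n ∸ ν)) (ℕ.m∸[m∸n]≡n ν≤n) ⟩
      (n C ν) · α₂ α ν (n ∸ ν)                              ∎

    Cpoly≈sum-α₂ : ∀ n x → Cpoly α n x ≈ sumTo n (λ ν → bin n ν (α₂ α ν (n ∸ ν) * pow x (n ∸ ν)))
    Cpoly≈sum-α₂ n x = trans (sumTo-reverse n _) (sumTo-cong n term)
      where
      term : ∀ ν → ν ≤ n → a α n (n ∸ ν) * x ^ (n ∸ ν) ≈ bin n ν (α₂ α ν (n ∸ ν) * x ^ (n ∸ ν))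
      term ν ν≤n = trans (*-congʳ (a-reflect≈bin-α₂ n ν ν≤n)) (×-assoc-* (n C ν) _ _)

    A-at-0 : ∀ m → A α m 0# ≈ α m
    A-at-0 m = trans (sumTo-head m _ vanish) (trans (+-identityʳ _) (*-identityʳ _))
      where
      vanish : ∀ i → bin m (suc i) (α (m ∸ suc i) * 0# ^ suc i) ≈ 0#
      vanish i = trans (×-congʳ (m C suc i) (trans (*-congˡ (zeroˡ _)) (zeroʳ _))) (·-zeroʳ (m C suc i))

    A-at-1 : ∀ m → A α m 1# ≈ α₂ α m 0
    A-at-1 m = begin
      A α m 1#                                        ≈⟨ sumTo-cong m (λ ν _ → ×-congʳ (m C ν) (trans (*-congˡ (1^n≈1 ν)) (*-identityʳ _))) ⟩
      sumTo m (λ ν → bin m ν (α (m ∸ ν)))             ≈⟨ sumTo-reverse m _ ⟩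
      sumTo m (λ ν → bin m (m ∸ ν) (α (m ∸ (m ∸ ν)))) ≈⟨ sumTo-cong m reflect ⟩
      α₂ α m 0                                        ∎
      where
      reflect : ∀ ν → ν ≤ m → bin m (m ∸ ν) (α (m ∸ (m ∸ ν))) ≈ bin m ν (α ν)
      reflect ν ν≤m = reflexive (≡.cong₂ (λ b j → b · α j) (≡.sym (nCk≡nC[n∸k] ν≤m)) (ℕ.m∸[m∸n]≡n ν≤m))

    A-cong : ∀ m {x y} → x ≈ y → A α m x ≈ A α m y
    A-cong m x≈y = sumTo-cong m (λ ν _ → ×-congʳ (m C ν) (*-congˡ (^-congˡ ν x≈y)))

    module _ (reflection : (m : ℕ) → (x : Carrier) → A α m (1# - x) ≈ sgn m * A α m x) where

      α₂-zeroʳ : ∀ m → α₂ α m 0 ≈ sgn m * α m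
      α₂-zeroʳ m = begin
        α₂ α m 0            ≈⟨ A-at-1 m ⟨
        A α m 1#            ≈⟨ A-cong m (trans (+-congˡ -0#≈0#) (+-identityʳ 1#)) ⟨
        A α m (1# - 0#)     ≈⟨ reflection m 0# ⟩
        sgn m * A α m 0#    ≈⟨ *-congˡ (A-at-0 m) ⟩
        sgn m * α m         ∎

      α₂-swap : ∀ s r → α₂ α r s ≈ sgn (r ℕ.+ s) * α₂ α s r
      α₂-swap zero    r = begin
        α₂ α r 0                      ≈⟨ α₂-zeroʳ r ⟩
        sgn r * α r                   ≡⟨ ≡.cong (λ k → sgn k * α r) (ℕ.+-identityʳ r) ⟨
        sgn (r ℕ.+ 0) * α r           ≈⟨ *-congˡ (α₂-zeroˡ r) ⟨
        sgn (r ℕ.+ 0) * α₂ α 0 r      ∎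
      α₂-swap (suc s) r = sym (begin
        sgn (r ℕ.+ suc s) * α₂ α (suc s) r                    ≡⟨ ≡.cong (λ k → sgn k * α₂ α (suc s) r) (ℕ.+-suc r s) ⟩
        (- 1# * σ) * α₂ α (suc s) r                           ≈⟨ *-congˡ (α₂-pascal s r) ⟩
        (- 1# * σ) * (α₂ α s r + α₂ α s (suc r))              ≈⟨ distribˡ _ _ _ ⟩
        (- 1# * σ) * α₂ α s r + sgn (suc r ℕ.+ s) * α₂ α s (suc r) ≈⟨ +-cong (trans (*-assoc _ _ _) (-1*x≈-x _)) (sym (α₂-swap s (suc r))) ⟩
        - (σ * α₂ α s r) + α₂ α (suc r) s                     ≈⟨ +-cong (-‿cong (sym (α₂-swap s r))) (α₂-pascal r s) ⟩
        - α₂ α r s + (α₂ α r s + α₂ α r (suc s))              ≈⟨ -x+[x+y]≈y _ _ ⟩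
        α₂ α r (suc s)                                        ∎)
        where
        σ : Carrier
        σ = sgn (r ℕ.+ s)

      a-antisymmetric : ∀ n ν → ν ≤ n → a α n ν ≈ sgn n * a α n (n ∸ ν)
      a-antisymmetric n ν ν≤n = begin
        a α n ν                                        ≈⟨ a≈bin-α₂ n ν ν≤n ⟩
        (n C ν) · α₂ α (n ∸ ν) ν                       ≈⟨ ×-congʳ (n C ν) (α₂-swap ν (n ∸ ν)) ⟩
        (n C ν) · (sgn (n ∸ ν ℕ.+ ν) * α₂ α ν (n ∸ ν)) ≡⟨ ≡.cong (λ k → (n C ν) · (sgn k * α₂ α ν (n ∸ ν))) (ℕ.m∸n+n≡m ν≤n) ⟩
        (n C ν) · (sgn n * α₂ α ν (n ∸ ν))             ≈⟨ ×-comm-* (n C ν) _ _ ⟨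
        sgn n * ((n C ν) · α₂ α ν (n ∸ ν))             ≈⟨ *-congˡ (a-reflect≈bin-α₂ n ν ν≤n) ⟨
        sgn n * a α n (n ∸ ν)                          ∎

      Cpoly-reciprocal : ∀ n x y → x * y ≈ 1# → Cpoly α n x ≈ sgn n * (pow x n * Cpoly α n y)
      Cpoly-reciprocal n x y xy≈1 = sym (begin
        sgn n * (x ^ n * Cpoly α n y)                        ≈⟨ *-congˡ (*-distribˡ-sumTo _ n _) ⟩
        sgn n * sumTo n (λ k → x ^ n * (a α n k * y ^ k))    ≈⟨ *-distribˡ-sumTo _ n _ ⟩
        sumTo n (λ k → sgn n * (x ^ n * (a α n k * y ^ k)))  ≈⟨ sumTo-cong n term ⟩
        sumTo n (λ k → a α n (n ∸ k) * x ^ (n ∸ k))          ≈⟨ sumTo-reverse n _ ⟨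
        Cpoly α n x                                          ∎)
        where
        term : ∀ k → k ≤ n → sgn n * (x ^ n * (a α n k * y ^ k)) ≈ a α n (n ∸ k) * x ^ (n ∸ k)
        term k k≤n = begin
          sgn n * (x ^ n * (a α n k * y ^ k))   ≈⟨ *-congˡ (*-x∙yz≈y∙xz _ _ _) ⟩
          sgn n * (a α n k * (x ^ n * y ^ k))   ≈⟨ *-assoc _ _ _ ⟨
          (sgn n * a α n k) * (x ^ n * y ^ k)   ≈⟨ *-cong (sym a-reflect) (xy≈1⇒xⁿyᵏ≈xⁿ⁻ᵏ xy≈1 k≤n) ⟩
          a α n (n ∸ k) * x ^ (n ∸ k)           ∎
          where
          a-reflect : a α n (n ∸ k) ≈ sgn n * a α n k
          a-reflect = trans (a-antisymmetric n (n ∸ k) (ℕ.m∸n≤m n k))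
                            (*-congˡ (reflexive (≡.cong (a α n) (ℕ.m∸[m∸n]≡n k≤n))))

corollary3p4 : ∀ {c ℓ} (R : CommutativeRing c ℓ) → IsIntegralDomain R → HasCharZero R →
    let open CommutativeRing R in
    (α : ℕ → Carrier) →
      ((n : ℕ) → (x : Carrier) →
          Poly.Cpoly R α n x ≈ Poly.sumTo R n (λ ν → Poly.bin R n ν (Poly.α₂ R α ν (n ∸ ν) * Poly.pow R x (n ∸ ν))))
    × ((n ν : ℕ) → ν ≤ n → Poly.a R α n ν ≈ Poly.bin R n ν (Poly.α₂ R α (n ∸ ν) ν))
    × (((m : ℕ) → (x : Carrier) → Poly.A R α m (1# - x) ≈ Poly.sgn R m * Poly.A R α m x) →
          ((n : ℕ) → (x y : Carrier) → x * y ≈ 1# →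
              Poly.Cpoly R α n x ≈ Poly.sgn R n * (Poly.pow R x n * Poly.Cpoly R α n y))
        × ((n ν : ℕ) → ν ≤ n → Poly.a R α n ν ≈ Poly.sgn R n * Poly.a R α n (n ∸ ν)))
corollary3p4 R _ _ α =
    Cpoly≈sum-α₂ R α
  , a≈bin-α₂ R α
  , λ reflection → Cpoly-reciprocal R α reflection , a-antisymmetric R α reflection
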